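{- Let $F$ be a matroid of finite rank and let $M$ be any matroid. Then the union $F\vee M$ is a matroid.
   Context: A matroid is a pair $M=(E,\mathcal L)$, where $E$ is a possibly infinite set and $\mathcal L\subseteq 2^E$ satisfies: (I1) $\emptyset\in\mathcal L$; (I2) if $B\in\mathcal L$ and $A\subseteq B$ then $A\in\mathcal L$; (I3) if $B$ is a maximal element of $\mathcal L$ and $A\in\mathcal L$ is not maximal, then there is $b\in B\setminus A$ with $A\cup\{b\}\in\mathcal L$; (I4) if $A\in\mathcal L$ and $A\subseteq X\subseteq E$, then $\{S\in\mathcal L: A\subseteq S\subseteq X\}$ has a maximal element. Maximal independent sets are bases. A matroid has finite rank if it has a finite base (then all bases have the same finite cardinality). For matroids $F=(E_F,\mathcal L_F)$ and $M=(E_M,\mathcal L_M)$ (ground sets not necessarily disjoint or equal), the union is $F\vee M=(E_F\cup E_M,\{S\cup T: S\in\mathcal L_F,T\in\mathcal L_M\})$. -}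

module Defs where

open import Level using (Level; 0ℓ) renaming (suc to lsuc)
open import Data.Product using (Σ; ∃; ∃-syntax; _×_; _,_)
open import Data.List using (List)
open import Data.List.Membership.Propositional using () renaming (_∈_ to _∈ˡ_)
open import Relation.Nullary using (¬_)
open import Relation.Binary.PropositionalEquality using (_≡_)
open import Relation.Unary using (Pred; _⊆_; _∪_; ∅)

Subset : Set → Set₁
Subset U = Pred U 0ℓ

-- A family of subsets (e.g. the independent sets). It is Set₁-valued so that
-- families defined by quantifying over subsets (such as the union family) fit.
Family : Set → Set₂
Family U = Pred (Subset U) (lsuc 0ℓ)

｛_｝ : {U : Set} → U → Subset U
｛ b ｝ = λ x → x ≡ b

IsMaximal : {U : Set} → Family U → Subset U → Set₁
IsMaximal {U} 𝒫 S = 𝒫 S × (∀ (T : Subset U) → 𝒫 T → S ⊆ T → T ⊆ S)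

record IsMatroid {U : Set} (E : Subset U) (𝓛 : Family U) : Set₂ where
  field
    indep⊆E : ∀ (S : Subset U) → 𝓛 S → S ⊆ E
    I1 : 𝓛 ∅
    I2 : ∀ (A B : Subset U) → 𝓛 B → A ⊆ B → 𝓛 A
    I3 : ∀ (A B : Subset U) → IsMaximal 𝓛 B → 𝓛 A → ¬ IsMaximal 𝓛 A →
         ∃[ b ] (B b × ¬ A b × 𝓛 (A ∪ ｛ b ｝))
    I4 : ∀ (A X : Subset U) → 𝓛 A → A ⊆ X → X ⊆ E →
         ∃[ S ] IsMaximal (λ (T : Subset U) → 𝓛 T × A ⊆ T × T ⊆ X) S

IsBase : {U : Set} → Family U → Subset U → Set₁
IsBase 𝓛 B = IsMaximal 𝓛 B

IsFinite : {U : Set} → Subset U → Set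
IsFinite {U} S = ∃[ xs ] (∀ (x : U) → S x → x ∈ˡ xs)

HasFiniteRank : {U : Set} → Family U → Set₁
HasFiniteRank 𝓛 = ∃[ B ] (IsBase 𝓛 B × IsFinite B)

-- independent sets of the union F ∨ M: sets equal (extensionally) to S ∪ T
UnionFamily : {U : Set} → Family U → Family U → Family U
UnionFamily 𝓛F 𝓛M Z =
  ∃[ S ] ∃[ T ] (𝓛F S × 𝓛M T × Z ⊆ S ∪ T × S ∪ T ⊆ Z)

module Submission where

open import Defs
open import Level using (0ℓ) renaming (suc to lsuc)
open import Axiom.ExcludedMiddle using (ExcludedMiddle)
open import Axiom.DoubleNegationElimination using (DoubleNegationElimination; em⇒dne)
open import Relation.Unary using (_∪_; _∩_; _∖_; _⊆_; Decidable)
open import Relation.Unary.Properties using (∁?)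
open import Relation.Nullary using (¬_; Dec; yes; no)
open import Relation.Binary.PropositionalEquality using (_≡_; _≢_; refl; sym; trans; subst; cong)
open import Data.Product using (Σ; ∃-syntax; _×_; _,_; proj₁; proj₂)
open import Data.Sum using (inj₁; inj₂; [_,_]′)
open import Data.Empty using (⊥; ⊥-elim)
open import Data.Unit using (⊤; tt)
open import Data.Nat using (ℕ; zero; suc; _+_; _≤_; z≤n; s≤s)
open import Data.Nat.Properties using (≤-trans; m≤n⇒m≤1+n; n≮n; +-suc; +-identityʳ; +-comm; +-mono-≤; +-monoʳ-≤; module ≤-Reasoning)
open import Data.List using (List; []; _∷_; length; filter)
open import Data.List.Properties using (filter-notAll)
open import Data.List.Membership.Propositional using (_∈_; _∉_)
open import Data.List.Membership.Propositional.Properties using (∈-filter⁺; ∈-filter⁻)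
open import Data.List.Relation.Unary.Any as Any using (here; there)
open import Data.List.Relation.Unary.All using (lookup)
open import Data.List.Relation.Unary.All.Properties using (¬Any⇒All¬)
open import Data.List.Relation.Unary.Unique.Propositional using (Unique; []; _∷_)
open import Data.List.Relation.Unary.Unique.Propositional.Properties using () renaming (filter⁺ to unique-filter)

-- The argument is classical (excluded middle at levels 0 and 1); finite sets are handled through
-- duplicate-free lists, and a "last witness" principle for bounded properties of ℕ plays the role
-- of choosing a set of maximal size. A union-independent set W has a split W = S ⊔ T with S
-- F-independent and T M-independent, which makes I1, I2 and the ground-set condition immediate. For the union, every union-basis of Z has a split
-- whose M-part is an M-basis of Z. Choosing such a split of a union-basis W₁ so that its F-part
-- overlaps the F-part B₁ of another such split as much as possible forces the F-part to span
-- B₁, which bounds |B₁| (fPartBound). I4 then maximises |W ∖ I| over the candidates W, for an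
-- M-basis I of X, and I3 follows from the impossible chain |A₁| + 1 ≤ |C₁| ≤ |B₁| ≤ |A₁|.

module FiniteLists {U : Set} (em₀ : ExcludedMiddle 0ℓ) where

  dne₀ : DoubleNegationElimination 0ℓ
  dne₀ = em⇒dne em₀

  entries : List U → Subset U
  entries xs x = x ∈ xs

  decide : (P : Subset U) → Decidable P
  decide P x = em₀

  select : Subset U → List U → List U
  select P = filter (decide P)

  reject : Subset U → List U → List U
  reject P = filter (∁? (decide P))

  length-select-reject : ∀ (P : Subset U) xs →
                         length xs ≡ length (select P xs) + length (reject P xs)
  length-select-reject P [] = refl
  length-select-reject P (x ∷ xs) with em₀ {P x}
  ... | yes _ = cong suc (length-select-reject P xs)
  ... | no  _ = trans (cong suc (length-select-reject P xs)) (sym (+-suc _ _))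

  unique-cons : ∀ {x : U} {xs} → x ∉ xs → Unique xs → Unique (x ∷ xs)
  unique-cons {xs = xs} x∉xs u = ¬Any⇒All¬ xs x∉xs ∷ u

  unique-length-≤ : ∀ {xs ys} → Unique xs → entries xs ⊆ entries ys → length xs ≤ length ys
  unique-length-≤ {[]} _ _ = z≤n
  unique-length-≤ {x ∷ xs} {ys} (x≢xs ∷ u) xs⊆ys =
    ≤-trans (s≤s (unique-length-≤ u xs⊆ys-x))
            (filter-notAll (decide (_≢ x)) ys (Any.map (λ x≡y y≢x → y≢x (sym x≡y)) (xs⊆ys (here refl))))
    where
    xs⊆ys-x : entries xs ⊆ entries (select (_≢ x) ys)
    xs⊆ys-x y∈xs = ∈-filter⁺ (decide (_≢ x)) (xs⊆ys (there y∈xs)) (λ y≡x → lookup x≢xs y∈xs (sym y≡x))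

  length-remove-≤ : ∀ c {xs} → Unique xs → length xs ≤ suc (length (select (_≢ c) xs))
  length-remove-≤ c {xs} u = begin
    length xs                                                ≡⟨ length-select-reject (_≢ c) xs ⟩
    length (select (_≢ c) xs) + length (reject (_≢ c) xs)    ≤⟨ +-monoʳ-≤ (length (select (_≢ c) xs)) atMostOne ⟩
    length (select (_≢ c) xs) + 1                            ≡⟨ +-comm _ 1 ⟩
    suc (length (select (_≢ c) xs))                          ∎
    where
    open ≤-Reasoning
    atMostOne : length (reject (_≢ c) xs) ≤ 1
    atMostOne = unique-length-≤ {ys = c ∷ []} (unique-filter _ u)
                  (λ m → here (dne₀ (proj₂ (∈-filter⁻ (∁? (decide (_≢ c))) {xs = xs} m))))

  nothingIn[] : ∀ {x : U} → x ∉ []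
  nothingIn[] ()

  shrinkCover : ∀ {P Q : Subset U} {c cs} → P ⊆ entries (c ∷ cs) → Q ⊆ P → ¬ Q c → Q ⊆ entries cs
  shrinkCover P⊆ Q⊆P ¬Qc Qx with P⊆ (Q⊆P Qx)
  ... | here refl = ⊥-elim (¬Qc Qx)
  ... | there x∈cs = x∈cs

  dropPoint : ∀ {W J : Subset U} p {L} → Unique L → entries L ⊆ W ∖ J →
              Σ (List U) λ L' → Unique L' × entries L' ⊆ (W ∖ ｛ p ｝) ∖ J × length L ≤ suc (length L')
  dropPoint {W} {J} p {L} uL L⊆ = select (_≢ p) L , unique-filter _ uL , inside , length-remove-≤ p uL
    where
    inside : entries (select (_≢ p) L) ⊆ (W ∖ ｛ p ｝) ∖ J
    inside m with ∈-filter⁻ (decide (_≢ p)) {xs = L} m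
    ... | x∈L , x≢p = (proj₁ (L⊆ x∈L) , x≢p) , proj₂ (L⊆ x∈L)

  UniqueListIn : Subset U → ℕ → Set
  UniqueListIn S n = Σ (List U) λ L → Unique L × entries L ⊆ S × length L ≡ n

  record Enumeration (S : Subset U) : Set where
    field
      list     : List U
      unique   : Unique list
      sound    : entries list ⊆ S
      complete : S ⊆ entries list

-- A decidable property of ℕ that holds at 0 and is bounded has a last witness n: P n but not P (n + 1).
-- This replaces choosing a finite set of maximal size.
lastWitness : ∀ {ℓ} (P : ℕ → Set ℓ) → (∀ n → Dec (P n)) → (b : ℕ) → P 0 →
              (∀ n → P n → n ≤ b) → ∃[ n ] (P n × ¬ P (suc n))
lastWitness P P? b P0 bounded = go b 0 P0 (λ n Pn → subst (n ≤_) (sym (+-identityʳ b)) (bounded n Pn))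
  where
  go : ∀ d k → P k → (∀ n → P n → n ≤ d + k) → ∃[ n ] (P n × ¬ P (suc n))
  go zero    k Pk below = k , Pk , λ Psk → n≮n k (below (suc k) Psk)
  go (suc d) k Pk below with P? (suc k)
  ... | yes Psk = go d (suc k) Psk (λ n Pn → subst (n ≤_) (sym (+-suc d k)) (below n Pn))
  ... | no ¬Psk = k , Pk , ¬Psk

insert-⊆ : ∀ {U : Set} {A B : Subset U} {x} → A ⊆ B → B x → A ∪ ｛ x ｝ ⊆ B
insert-⊆ A⊆B Bx (inj₁ a) = A⊆B a
insert-⊆ A⊆B Bx (inj₂ refl) = Bx

insert-mono : ∀ {U : Set} {A B : Subset U} {x} → A ⊆ B → A ∪ ｛ x ｝ ⊆ B ∪ ｛ x ｝
insert-mono A⊆B (inj₁ a) = inj₁ (A⊆B a)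
insert-mono A⊆B (inj₂ e) = inj₂ e

⊆-without : ∀ {U : Set} {A B : Subset U} {p} → A ⊆ B → ¬ A p → A ⊆ B ∖ ｛ p ｝
⊆-without {A = A} A⊆B ¬Ap a = A⊆B a , λ x≡p → ¬Ap (subst A x≡p a)

record IsBasisOf {U : Set} (𝓛 : Family U) (X K : Subset U) : Set₁ where
  constructor basis
  field
    within  : K ⊆ X
    indep   : 𝓛 K
    maximal : ∀ {x} → X x → ¬ K x → ¬ 𝓛 (K ∪ ｛ x ｝)
open IsBasisOf

basis-restrict : ∀ {U : Set} {𝓛 : Family U} {X Y K : Subset U} →
                 IsBasisOf 𝓛 X K → K ⊆ Y → Y ⊆ X → IsBasisOf 𝓛 Y K
basis-restrict K-basis K⊆Y Y⊆X = basis K⊆Y (indep K-basis) (λ Yx → maximal K-basis (Y⊆X Yx))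

maximal⇒basis : ∀ {U : Set} {𝓛 : Family U} {K X : Subset U} → IsMaximal 𝓛 K → K ⊆ X → IsBasisOf 𝓛 X K
maximal⇒basis (lK , K-max) K⊆X = basis K⊆X lK (λ _ ¬Kx lKx → ¬Kx (K-max _ lKx inj₁ (inj₂ refl)))

selfBasis : ∀ {U : Set} {𝓛 : Family U} {W : Subset U} → 𝓛 W → IsBasisOf 𝓛 W W
selfBasis lW = basis (λ w → w) lW (λ Wx ¬Wx → ⊥-elim (¬Wx Wx))

augmentable : ∀ {U : Set} → ExcludedMiddle 0ℓ → ExcludedMiddle (lsuc 0ℓ) →
              {𝓛 : Family U} → (∀ {A B : Subset U} → 𝓛 B → A ⊆ B → 𝓛 A) →
              ∀ {A : Subset U} → 𝓛 A → ¬ IsMaximal 𝓛 A → ∃[ y ] (¬ A y × 𝓛 (A ∪ ｛ y ｝))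
augmentable em₀ em₁ downward {A} lA notMax = em⇒dne em₁ λ none → notMax (lA , λ T lT A⊆T {x} Tx →
  em⇒dne em₀ λ ¬Ax → none (x , ¬Ax , downward lT (insert-⊆ A⊆T Tx)))

module MatroidTheory {U : Set} (em₀ : ExcludedMiddle 0ℓ) (em₁ : ExcludedMiddle (lsuc 0ℓ))
                     {E : Subset U} {𝓛 : Family U} (M : IsMatroid E 𝓛) where
  open IsMatroid M
  open FiniteLists {U} em₀

  dne₁ : DoubleNegationElimination (lsuc 0ℓ)
  dne₁ = em⇒dne em₁

  indep-⊆ : ∀ {A B : Subset U} → 𝓛 B → A ⊆ B → 𝓛 A
  indep-⊆ {A} {B} = I2 A B

  extendToBasis : ∀ {A X : Subset U} → 𝓛 A → A ⊆ X → Σ (Subset U) λ K → A ⊆ K × IsBasisOf 𝓛 X K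
  extendToBasis {A} {X} lA A⊆X with I4 A (X ∩ E) lA (λ a → A⊆X a , indep⊆E A lA a) proj₂
  ... | K , (lK , A⊆K , K⊆X∩E) , K-max = K , A⊆K , basis (λ k → proj₁ (K⊆X∩E k)) lK saturated
    where
    saturated : ∀ {x} → X x → ¬ K x → ¬ 𝓛 (K ∪ ｛ x ｝)
    saturated {x} Xx ¬Kx lKx = ¬Kx (K-max (K ∪ ｛ x ｝) (lKx , (λ a → inj₁ (A⊆K a)) , K+x⊆X∩E) inj₁ (inj₂ refl))
      where
      K+x⊆X∩E : K ∪ ｛ x ｝ ⊆ X ∩ E
      K+x⊆X∩E = insert-⊆ K⊆X∩E (Xx , indep⊆E _ lKx (inj₂ refl))

  Everything : Subset U
  Everything _ = ⊤

  basis⇒maximal : ∀ {K : Subset U} → IsBasisOf 𝓛 Everything K → IsMaximal 𝓛 K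
  basis⇒maximal K-basis = indep K-basis , λ T lT K⊆T {x} Tx →
    dne₀ λ ¬Kx → maximal K-basis tt ¬Kx (indep-⊆ lT (insert-⊆ K⊆T Tx))

  notMaximal : ∀ {D T : Subset U} {x} → 𝓛 T → D ⊆ T → T x → ¬ D x → ¬ IsMaximal 𝓛 D
  notMaximal lT D⊆T Tx ¬Dx (_ , D-max) = ¬Dx (D-max _ lT D⊆T Tx)

  -- Assuming no b ∈ B ∖ A works, a base G ⊇ A ∪ {y}
  -- is built from a base B⁺ ⊇ B, and exchanging in B ∪ (G ∖ Y) produces a point contradicting that B
  -- is a basis of Y.
  basisAugment : ∀ {Y B A : Subset U} {y} → IsBasisOf 𝓛 Y B → A ⊆ Y → 𝓛 A →
                 Y y → ¬ A y → 𝓛 (A ∪ ｛ y ｝) → ∃[ b ] (B b × ¬ A b × 𝓛 (A ∪ ｛ b ｝))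
  basisAugment {Y} {B} {A} {y} B-basis A⊆Y lA Yy ¬Ay lAy =
    dne₁ λ noAug → contradiction (λ {b} Bb ¬Ab lAb → noAug (b , Bb , ¬Ab , lAb))
    where
    contradiction : (∀ {b} → B b → ¬ A b → ¬ 𝓛 (A ∪ ｛ b ｝)) → ⊥
    contradiction stuck with extendToBasis {X = Everything} (indep B-basis) (λ _ → tt)
    ... | B⁺ , B⊆B⁺ , B⁺-basis with extendToBasis {X = (A ∪ ｛ y ｝) ∪ (B⁺ ∖ Y)} lAy inj₁
    ... | G , A+y⊆G , G-basis = finish outsider
      where
      B⁺-max : IsMaximal 𝓛 B⁺
      B⁺-max = basis⇒maximal B⁺-basis
      B⁺∩Y⊆B : ∀ {x} → B⁺ x → Y x → B x
      B⁺∩Y⊆B B⁺x Yx = dne₀ λ ¬Bx → maximal B-basis Yx ¬Bx (indep-⊆ (indep B⁺-basis) (insert-⊆ B⊆B⁺ B⁺x))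
      A⊆G : A ⊆ G
      A⊆G a = A+y⊆G (inj₁ a)
      -- G is a base of the whole matroid, for an augmenting element of B⁺ would lie in B or in B⁺ ∖ Y
      G-saturated : ∀ {x} → Everything x → ¬ G x → ¬ 𝓛 (G ∪ ｛ x ｝)
      G-saturated _ ¬Gx lGx with I3 G B⁺ B⁺-max (indep G-basis) (notMaximal lGx inj₁ (inj₂ refl) ¬Gx)
      ... | b , B⁺b , ¬Gb , lGb with em₀ {Y b}
      ... | yes Yb = stuck (B⁺∩Y⊆B B⁺b Yb) (λ Ab → ¬Gb (A⊆G Ab)) (indep-⊆ lGb (insert-mono {A = A} {x = b} A⊆G))
      ... | no ¬Yb = maximal G-basis (inj₂ (B⁺b , ¬Yb)) ¬Gb lGb
      -- exchanging y out of G brings in some s ∈ B⁺ lying outside both Y and G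
      outsider : ∃[ s ] (B⁺ s × ¬ Y s × ¬ G s)
      outsider with I3 (G ∖ ｛ y ｝) B⁺ B⁺-max (indep-⊆ (indep G-basis) proj₁)
                       (notMaximal (indep G-basis) proj₁ (A+y⊆G (inj₂ refl)) (λ (_ , y≢y) → y≢y refl))
      ... | s , B⁺s , ¬G-ys , lG-ys = s , B⁺s , ¬Ys , λ Gs → ¬G-ys (Gs , λ s≡y → ¬Ys (subst Y (sym s≡y) Yy))
        where
        A⊆G-y : A ⊆ G ∖ ｛ y ｝
        A⊆G-y = ⊆-without A⊆G ¬Ay
        ¬Ys : ¬ Y s
        ¬Ys Ys = stuck (B⁺∩Y⊆B B⁺s Ys) (λ As → ¬G-ys (A⊆G-y As)) (indep-⊆ lG-ys (insert-mono {A = A} {x = s} A⊆G-y))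
      B∪G-Y⊆B⁺ : B ∪ (G ∖ Y) ⊆ B⁺
      B∪G-Y⊆B⁺ (inj₁ b) = B⊆B⁺ b
      B∪G-Y⊆B⁺ (inj₂ (Gx , ¬Yx)) with within G-basis Gx
      ... | inj₁ (inj₁ a) = ⊥-elim (¬Yx (A⊆Y a))
      ... | inj₁ (inj₂ refl) = ⊥-elim (¬Yx Yy)
      ... | inj₂ (B⁺x , _) = B⁺x
      -- B ∪ (G ∖ Y) misses s ∈ B⁺, so the base G augments it; the new element contradicts B being a basis of Y
      finish : ∃[ s ] (B⁺ s × ¬ Y s × ¬ G s) → ⊥
      finish (s , B⁺s , ¬Ys , ¬Gs)
        with I3 (B ∪ (G ∖ Y)) G (basis⇒maximal (basis (λ _ → tt) (indep G-basis) G-saturated))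
                (indep-⊆ (indep B⁺-basis) B∪G-Y⊆B⁺) (notMaximal (indep B⁺-basis) B∪G-Y⊆B⁺ B⁺s ¬B∪G-Y)
        where
        ¬B∪G-Y : ¬ (B ∪ (G ∖ Y)) s
        ¬B∪G-Y (inj₁ Bs) = ¬Ys (within B-basis Bs)
        ¬B∪G-Y (inj₂ (Gs , _)) = ¬Gs Gs
      ... | g , Gg , ¬B∪G-Yg , lg with em₀ {Y g}
      ... | yes Yg = maximal B-basis Yg (λ Bg → ¬B∪G-Yg (inj₁ Bg)) (indep-⊆ lg (insert-mono {A = B} {B = B ∪ (G ∖ Y)} {x = g} inj₁))
      ... | no ¬Yg = ¬B∪G-Yg (inj₂ (Gg , ¬Yg))

  exchangeBasis : ∀ {Y K : Subset U} {x k} → IsBasisOf 𝓛 Y K → Y k → ¬ K k →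
                  𝓛 ((K ∖ ｛ x ｝) ∪ ｛ k ｝) → IsBasisOf 𝓛 Y ((K ∖ ｛ x ｝) ∪ ｛ k ｝)
  exchangeBasis {Y} {K} {x} {k} K-basis Yk ¬Kk lK' = basis K'⊆Y lK' saturated
    where
    K' : Subset U
    K' = (K ∖ ｛ x ｝) ∪ ｛ k ｝
    K'⊆Y : K' ⊆ Y
    K'⊆Y = insert-⊆ {A = K ∖ ｛ x ｝} (λ (Kz , _) → within K-basis Kz) Yk
    saturated : ∀ {z} → Y z → ¬ K' z → ¬ 𝓛 (K' ∪ ｛ z ｝)
    saturated Yz ¬K'z lK'z with basisAugment K-basis K'⊆Y lK' Yz ¬K'z lK'z
    ... | b , Kb , ¬K'b , lK'b with em₀ {b ≡ x}
    ... | no b≢x = ¬K'b (inj₁ (Kb , b≢x))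
    ... | yes b≡x = maximal K-basis Yk ¬Kk (indep-⊆ lK'b K+k⊆K'+b)
      where
      K+k⊆K'+b : K ∪ ｛ k ｝ ⊆ K' ∪ ｛ b ｝
      K+k⊆K'+b {w} (inj₁ Kw) with em₀ {w ≡ x}
      ... | yes w≡x = inj₂ (trans w≡x (sym b≡x))
      ... | no w≢x = inj₁ (inj₁ (Kw , w≢x))
      K+k⊆K'+b (inj₂ w≡k) = inj₁ (inj₂ w≡k)

  basis-lift : ∀ {Y Z J K : Subset U} → IsBasisOf 𝓛 Y J → J ⊆ Z → Z ⊆ Y →
               IsBasisOf 𝓛 Z K → IsBasisOf 𝓛 Y K
  basis-lift {Y} {K = K} J-basis J⊆Z Z⊆Y K-basis = basis K⊆Y (indep K-basis) saturated
    where
    K⊆Y : K ⊆ Y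
    K⊆Y k = Z⊆Y (within K-basis k)
    saturated : ∀ {x} → Y x → ¬ K x → ¬ 𝓛 (K ∪ ｛ x ｝)
    saturated Yx ¬Kx lKx with basisAugment J-basis K⊆Y (indep K-basis) Yx ¬Kx lKx
    ... | b , Jb , ¬Kb , lKb = maximal K-basis (J⊆Z Jb) ¬Kb lKb

  singleDefect : ∀ {K Q : Subset U} {c k₁ k₂} → 𝓛 K → IsBasisOf 𝓛 (K ∪ ｛ c ｝) Q → Q c →
                 (K ∖ Q) k₁ → (K ∖ Q) k₂ → k₁ ≡ k₂
  singleDefect {K} {Q} {c} {k₁} {k₂} lK Q-basis Qc (Kk₁ , ¬Qk₁) (Kk₂ , ¬Qk₂) = dne₀ distinct⇒⊥
    where
    D : Subset U
    D = (Q ∩ K) ∪ ｛ k₁ ｝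
    D⊆K : D ⊆ K
    D⊆K = insert-⊆ {A = Q ∩ K} proj₂ Kk₁
    ¬Dk₂ : k₁ ≢ k₂ → ¬ D k₂
    ¬Dk₂ k₁≢k₂ (inj₁ (Qk₂ , _)) = ¬Qk₂ Qk₂
    ¬Dk₂ k₁≢k₂ (inj₂ k₂≡k₁) = k₁≢k₂ (sym k₂≡k₁)
    Q+k₁⊆D+c : Q ∪ ｛ k₁ ｝ ⊆ D ∪ ｛ c ｝
    Q+k₁⊆D+c (inj₁ Qz) with within Q-basis Qz
    ... | inj₁ Kz = inj₁ (inj₁ (Qz , Kz))
    ... | inj₂ z≡c = inj₂ z≡c
    Q+k₁⊆D+c (inj₂ z≡k₁) = inj₁ (inj₂ z≡k₁)
    -- if k₂ ≠ k₁, the element of Q augmenting D must be c, and then Q ∪ {k₁} would be independent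
    distinct⇒⊥ : k₁ ≢ k₂ → ⊥
    distinct⇒⊥ k₁≢k₂ with basisAugment Q-basis (λ d → inj₁ (D⊆K d)) (indep-⊆ lK D⊆K) (inj₁ Kk₂) (¬Dk₂ k₁≢k₂)
                              (indep-⊆ lK (insert-⊆ D⊆K Kk₂))
    ... | b , Qb , ¬Db , lDb with within Q-basis Qb
    ... | inj₁ Kb = ¬Db (inj₁ (Qb , Kb))
    ... | inj₂ refl = maximal Q-basis (inj₁ Kk₁) ¬Qk₁ (indep-⊆ lDb Q+k₁⊆D+c)

  record Exchange (J K : Subset U) (c : U) : Set₁ where
    field
      Q        : Subset U
      k₀       : U
      Q-basis  : IsBasisOf 𝓛 (K ∪ ｛ c ｝) Q
      Qc       : Q c
      Kk₀      : K k₀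
      ¬Qk₀     : ¬ Q k₀
      ¬Jk₀     : ¬ J k₀
      only-k₀  : ∀ {k} → K k → ¬ Q k → k ≡ k₀

  -- Q extends (K ∩ J) ∪ {c}, so the lost element cannot lie in J
  exchange : ∀ {J K : Subset U} {c} → 𝓛 J → J c → 𝓛 K → ¬ 𝓛 (K ∪ ｛ c ｝) → Exchange J K c
  exchange {J} {K} {c} lJ Jc lK dependent
    with extendToBasis {A = (K ∩ J) ∪ ｛ c ｝} {X = K ∪ ｛ c ｝} (indep-⊆ lJ (insert-⊆ {A = K ∩ J} proj₂ Jc)) (insert-mono {A = K ∩ J} proj₁)
  ... | Q , K∩J+c⊆Q , Q-basis = record
    { Q = Q ; k₀ = k₀ ; Q-basis = Q-basis ; Qc = Qc ; Kk₀ = Kk₀ ; ¬Qk₀ = ¬Qk₀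
    ; ¬Jk₀ = λ Jk₀ → ¬Qk₀ (K∩J+c⊆Q (inj₁ (Kk₀ , Jk₀)))
    ; only-k₀ = λ Kk ¬Qk → singleDefect lK Q-basis Qc (Kk , ¬Qk) (Kk₀ , ¬Qk₀) }
    where
    Qc : Q c
    Qc = K∩J+c⊆Q (inj₂ refl)
    -- K ∪ {c} is dependent, so K is not contained in Q
    missing : ∃[ k ] (K k × ¬ Q k)
    missing = dne₀ λ none → dependent (indep-⊆ (indep Q-basis)
                (insert-⊆ (λ {k} Kk → dne₀ λ ¬Qk → none (k , Kk , ¬Qk)) Qc))
    k₀ : U
    k₀ = proj₁ missing
    Kk₀ : K k₀
    Kk₀ = proj₁ (proj₂ missing)
    ¬Qk₀ : ¬ Q k₀
    ¬Qk₀ = proj₂ (proj₂ missing)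

  -- Induction on cs: each point c either is irrelevant, joins K, is discarded
  -- from W, or is exchanged into K at the cost of one point discarded from W.
  basisDefect : ∀ {W J K : Subset U} (cs : List U) → IsBasisOf 𝓛 W J → K ⊆ W → 𝓛 K →
                W ∖ K ⊆ entries cs → ∀ {L} → Unique L → entries L ⊆ W ∖ J → length L ≤ length cs
  basisDefect [] J-basis K⊆W lK cover {[]} uL L⊆ = z≤n
  basisDefect {W} {J} {K} [] J-basis K⊆W lK cover {x ∷ L} uL L⊆ with L⊆ (here refl)
  ... | Wx , ¬Jx = ⊥-elim (maximal J-basis Wx ¬Jx (indep-⊆ lK (insert-⊆ (λ j → W⊆K (within J-basis j)) (W⊆K Wx))))
    where
    W⊆K : W ⊆ K
    W⊆K Wy = dne₀ λ ¬Ky → nothingIn[] (cover (Wy , ¬Ky))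
  basisDefect {W} {J} {K} (c ∷ cs) J-basis K⊆W lK cover {L} uL L⊆ with em₀ {(W ∖ K) c}
  ... | no c∉W∖K = m≤n⇒m≤1+n (basisDefect cs J-basis K⊆W lK (shrinkCover cover (λ w → w) c∉W∖K) uL L⊆)
  ... | yes (Wc , ¬Kc) with em₁ {𝓛 (K ∪ ｛ c ｝)}
  ...   | yes lK+c = m≤n⇒m≤1+n (basisDefect cs J-basis (insert-⊆ K⊆W Wc) lK+c
                                  (shrinkCover {Q = W ∖ (K ∪ ｛ c ｝)} cover (λ (w , ¬k) → w , λ k → ¬k (inj₁ k)) (λ (_ , ¬k) → ¬k (inj₂ refl)))
                                  uL L⊆)
  ...   | no dependent with em₀ {J c}
  ...     | no ¬Jc = let (L' , uL' , L'⊆ , L≤) = dropPoint c uL L⊆ in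
    ≤-trans L≤ (s≤s (basisDefect cs (basis-restrict J-basis (⊆-without (within J-basis) ¬Jc) proj₁)
                                     (⊆-without K⊆W ¬Kc) lK
                                     (shrinkCover {Q = (W ∖ ｛ c ｝) ∖ K} cover (λ ((w , _) , ¬k) → w , ¬k) (λ ((_ , c≢c) , _) → c≢c refl))
                                     uL' L'⊆))
  -- c ∈ J: exchange c into K at the cost of one element k₀ ∉ J, which is discarded from W
  ...     | yes Jc with exchange (indep J-basis) Jc lK dependent
  ...       | ex = let (L' , uL' , L'⊆ , L≤) = dropPoint (Exchange.k₀ ex) uL L⊆ in
    ≤-trans L≤ (s≤s (basisDefect cs (basis-restrict J-basis (⊆-without (within J-basis) ¬Jk₀) proj₁)
                                     Q⊆W-k₀ (indep Q-basis) (shrinkCover cover W-k₀∖Q⊆W∖K (λ (_ , ¬Qc) → ¬Qc Qc))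
                                     uL' L'⊆))
    where
    open Exchange ex
    Q⊆W-k₀ : Q ⊆ W ∖ ｛ k₀ ｝
    Q⊆W-k₀ = ⊆-without (λ q → insert-⊆ K⊆W Wc (within Q-basis q)) ¬Qk₀
    W-k₀∖Q⊆W∖K : (W ∖ ｛ k₀ ｝) ∖ Q ⊆ W ∖ K
    W-k₀∖Q⊆W∖K ((Wx , x≢k₀) , ¬Qx) = Wx , λ Kx → x≢k₀ (only-k₀ Kx ¬Qx)

  independentBound : ∀ {W J K : Subset U} (cs : List U) → IsBasisOf 𝓛 W J → K ⊆ W → 𝓛 K →
                     W ⊆ J ∪ K → J ⊆ entries cs → ∀ {L} → Unique L → entries L ⊆ K → length L ≤ length cs
  independentBound {W} {J} {K} cs J-basis K⊆W lK W⊆J∪K J⊆cs {L} uL L⊆K = begin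
    length L                                          ≡⟨ length-select-reject J L ⟩
    length (select J L) + length (reject J L)         ≤⟨ +-mono-≤ inJ outsideJ ⟩
    length (select K cs) + length (reject K cs)       ≡⟨ sym (length-select-reject K cs) ⟩
    length cs                                         ∎
    where
    open ≤-Reasoning
    inJ : length (select J L) ≤ length (select K cs)
    inJ = unique-length-≤ (unique-filter _ uL) λ m →
      let (x∈L , Jx) = ∈-filter⁻ (decide J) {xs = L} m in ∈-filter⁺ (decide K) (J⊆cs Jx) (L⊆K x∈L)
    cover : W ∖ K ⊆ entries (reject K cs)
    cover (Wx , ¬Kx) with W⊆J∪K Wx
    ... | inj₁ Jx = ∈-filter⁺ (∁? (decide K)) (J⊆cs Jx) ¬Kx
    ... | inj₂ Kx = ⊥-elim (¬Kx Kx)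
    outsideJ : length (reject J L) ≤ length (reject K cs)
    outsideJ = basisDefect (reject K cs) J-basis K⊆W lK cover (unique-filter _ uL) λ m →
      let (x∈L , ¬Jx) = ∈-filter⁻ (∁? (decide J)) {xs = L} m in K⊆W (L⊆K x∈L) , ¬Jx

  module FiniteRank {B₀ : Subset U} (B₀-max : IsMaximal 𝓛 B₀) (bs : List U) (B₀⊆bs : B₀ ⊆ entries bs) where

    -- B₀ is a basis of L ∪ B₀ for every list L, so independent sets have at most |bs| elements
    rankBound : ∀ {S : Subset U} → 𝓛 S → ∀ {L} → Unique L → entries L ⊆ S → length L ≤ length bs
    rankBound lS {L} uL L⊆S =
      independentBound bs (maximal⇒basis B₀-max inj₂) inj₁ (indep-⊆ lS L⊆S) swap B₀⊆bs uL (λ m → m)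
      where
      swap : entries L ∪ B₀ ⊆ B₀ ∪ entries L
      swap (inj₁ m) = inj₂ m
      swap (inj₂ b) = inj₁ b

    -- a longest duplicate-free list inside an independent S lists all of S
    enumerate : ∀ {S : Subset U} → 𝓛 S → Enumeration S
    enumerate {S} lS with lastWitness (UniqueListIn S) (λ _ → em₀) (length bs) ([] , [] , (λ ()) , refl)
                                      (λ n (L , uL , L⊆S , |L|≡n) → subst (_≤ length bs) |L|≡n (rankBound lS uL L⊆S))
    ... | _ , (L , uL , L⊆S , refl) , noLonger =
      record { list = L ; unique = uL ; sound = L⊆S ; complete = complete }
      where
      complete : S ⊆ entries L
      complete {x} Sx = dne₀ λ x∉L → noLonger (x ∷ L , unique-cons x∉L uL , insert-entries , refl)
        where
        insert-entries : entries (x ∷ L) ⊆ S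
        insert-entries (here refl) = Sx
        insert-entries (there m) = L⊆S m

module UnionMatroid {U : Set} (em₀ : ExcludedMiddle 0ℓ) (em₁ : ExcludedMiddle (lsuc 0ℓ))
                    {EF EM : Subset U} {𝓛F 𝓛M : Family U} (MF : IsMatroid EF 𝓛F) (MM : IsMatroid EM 𝓛M) where
  open FiniteLists {U} em₀
  module F = MatroidTheory em₀ em₁ MF
  module M = MatroidTheory em₀ em₁ MM

  𝓤 : Family U
  𝓤 = UnionFamily 𝓛F 𝓛M

  union-indep : ∀ {W S T : Subset U} → 𝓛F S → 𝓛M T → W ⊆ S ∪ T → S ⊆ W → T ⊆ W → 𝓤 W
  union-indep {S = S} {T} lS lT W⊆S∪T S⊆W T⊆W = S , T , lS , lT , W⊆S∪T , S∪T⊆W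
    where
    S∪T⊆W : S ∪ T ⊆ _
    S∪T⊆W (inj₁ s) = S⊆W s
    S∪T⊆W (inj₂ t) = T⊆W t

  record Split (W S T : Subset U) : Set₁ where
    constructor mkSplit
    field
      indepF   : 𝓛F S
      indepM   : 𝓛M T
      S⊆W      : S ⊆ W
      T⊆W      : T ⊆ W
      covers   : W ⊆ S ∪ T
      disjoint : ∀ {x} → S x → ¬ T x
  open Split

  split : ∀ {W : Subset U} → 𝓤 W → ∃[ S ] ∃[ T ] Split W S T
  split {W} (S , T , lS , lT , W⊆S∪T , _) =
    W ∩ S , (W ∩ T) ∖ S ,
    mkSplit (F.indep-⊆ lS proj₂) (M.indep-⊆ lT (λ ((_ , t) , _) → t)) proj₁ (λ ((w , _) , _) → w)
            cover (λ (_ , s) (_ , ¬s) → ¬s s)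
    where
    cover : W ⊆ (W ∩ S) ∪ ((W ∩ T) ∖ S)
    cover {x} Wx with W⊆S∪T Wx | em₀ {S x}
    ... | _       | yes Sx = inj₁ (Wx , Sx)
    ... | inj₁ Sx | no ¬Sx = ⊥-elim (¬Sx Sx)
    ... | inj₂ Tx | no ¬Sx = inj₂ ((Wx , Tx) , ¬Sx)

  union-I2 : ∀ {A B : Subset U} → 𝓤 B → A ⊆ B → 𝓤 A
  union-I2 {A} (S , T , lS , lT , B⊆S∪T , _) A⊆B =
    union-indep (F.indep-⊆ lS proj₂) (M.indep-⊆ lT proj₂) cover proj₁ proj₁
    where
    cover : A ⊆ (A ∩ S) ∪ (A ∩ T)
    cover Ax with B⊆S∪T (A⊆B Ax)
    ... | inj₁ Sx = inj₁ (Ax , Sx)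
    ... | inj₂ Tx = inj₂ (Ax , Tx)

  extendF : ∀ {W S T : Subset U} {x} → Split W S T → 𝓛F (S ∪ ｛ x ｝) → 𝓤 (W ∪ ｛ x ｝)
  extendF {W} {S} {T} {x} sp lS+x =
    union-indep lS+x (indepM sp) cover (insert-mono {A = S} (S⊆W sp)) (λ t → inj₁ (T⊆W sp t))
    where
    cover : W ∪ ｛ x ｝ ⊆ (S ∪ ｛ x ｝) ∪ T
    cover (inj₁ w) = [ (λ s → inj₁ (inj₁ s)) , inj₂ ]′ (covers sp w)
    cover (inj₂ e) = inj₁ (inj₂ e)

  extendM : ∀ {W S T : Subset U} {x} → Split W S T → 𝓛M (T ∪ ｛ x ｝) → 𝓤 (W ∪ ｛ x ｝)
  extendM {W} {S} {T} {x} sp lT+x =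
    union-indep (indepF sp) lT+x cover (λ s → inj₁ (S⊆W sp s)) (insert-mono {A = T} (T⊆W sp))
    where
    cover : W ∪ ｛ x ｝ ⊆ S ∪ (T ∪ ｛ x ｝)
    cover (inj₁ w) = [ inj₁ , (λ t → inj₂ (inj₁ t)) ]′ (covers sp w)
    cover (inj₂ e) = inj₂ (inj₂ e)

  split-left : ∀ {W S T : Subset U} {x} → Split W S T → W x → ¬ T x → S x
  split-left sp Wx ¬Tx = [ (λ s → s) , (λ t → ⊥-elim (¬Tx t)) ]′ (covers sp Wx)

  split-right : ∀ {W S T : Subset U} {x} → Split W S T → W x → ¬ S x → T x
  split-right sp Wx ¬Sx = [ (λ s → ⊥-elim (¬Sx s)) , (λ t → t) ]′ (covers sp Wx)

  swapSplit : ∀ {W S T : Subset U} {x k} → Split W S T → T x → S k →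
              𝓛F (S ∪ ｛ x ｝) → 𝓛M ((T ∖ ｛ x ｝) ∪ ｛ k ｝) →
              Split W ((S ∪ ｛ x ｝) ∖ ｛ k ｝) ((T ∖ ｛ x ｝) ∪ ｛ k ｝)
  swapSplit {W} {S} {T} {x} {k} sp Tx Sk lS+x lT' = mkSplit (F.indep-⊆ lS+x proj₁) lT' S'⊆W T'⊆W cover disj
    where
    k≢x : k ≢ x
    k≢x k≡x = disjoint sp Sk (subst T (sym k≡x) Tx)
    S'⊆W : (S ∪ ｛ x ｝) ∖ ｛ k ｝ ⊆ W
    S'⊆W (s , _) = insert-⊆ (S⊆W sp) (T⊆W sp Tx) s
    T'⊆W : (T ∖ ｛ x ｝) ∪ ｛ k ｝ ⊆ W
    T'⊆W = insert-⊆ {A = T ∖ ｛ x ｝} (λ (t , _) → T⊆W sp t) (S⊆W sp Sk)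
    cover : W ⊆ ((S ∪ ｛ x ｝) ∖ ｛ k ｝) ∪ ((T ∖ ｛ x ｝) ∪ ｛ k ｝)
    cover {z} Wz with covers sp Wz
    ... | inj₁ Sz with em₀ {z ≡ k}
    ...   | yes z≡k = inj₂ (inj₂ z≡k)
    ...   | no z≢k = inj₁ (inj₁ Sz , z≢k)
    cover {z} Wz | inj₂ Tz with em₀ {z ≡ x}
    ...   | yes z≡x = inj₁ (inj₂ z≡x , λ z≡k → k≢x (trans (sym z≡k) z≡x))
    ...   | no z≢x = inj₂ (inj₁ (Tz , z≢x))
    disj : ∀ {z} → ((S ∪ ｛ x ｝) ∖ ｛ k ｝) z → ¬ ((T ∖ ｛ x ｝) ∪ ｛ k ｝) z
    disj (inj₁ Sz , _) (inj₁ (Tz , _)) = disjoint sp Sz Tz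
    disj (inj₂ z≡x , _) (inj₁ (_ , z≢x)) = z≢x z≡x
    disj (_ , z≢k) (inj₂ z≡k) = z≢k z≡k

  resplit : ∀ {W S T J : Subset U} → Split W S T → T ⊆ J → J ⊆ W → 𝓛M J → Split W (S ∖ J) J
  resplit {W} {S} {T} {J} sp T⊆J J⊆W lJ =
    mkSplit (F.indep-⊆ (indepF sp) proj₁) lJ (λ (s , _) → S⊆W sp s) J⊆W cover (λ (_ , ¬Jx) Jx → ¬Jx Jx)
    where
    cover : W ⊆ (S ∖ J) ∪ J
    cover {x} Wx with em₀ {J x}
    ... | yes Jx = inj₂ Jx
    ... | no ¬Jx = inj₁ (split-left sp Wx (λ Tx → ¬Jx (T⊆J Tx)) , ¬Jx)

  adaptedSplit : ∀ {Z W : Subset U} → IsBasisOf 𝓤 Z W → ∃[ S ] ∃[ J ] (Split W S J × IsBasisOf 𝓛M Z J)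
  adaptedSplit {W = W} W-basis with split (indep W-basis)
  ... | S , T , sp with M.extendToBasis (indepM sp) (λ t → within W-basis (T⊆W sp t))
  ... | J , T⊆J , J-basis = S ∖ J , J , resplit sp T⊆J J⊆W (indep J-basis) , J-basis
    where
    -- W is saturated in Z, so the M-independent J ⊆ Z cannot leave W
    J⊆W : J ⊆ W
    J⊆W Jx = dne₀ λ ¬Wx → maximal W-basis (within J-basis Jx) ¬Wx
                             (extendM sp (M.indep-⊆ (indep J-basis) (insert-⊆ T⊆J Jx)))

  Overlap : (Y W B : Subset U) → ℕ → Set₁
  Overlap Y W B n = ∃[ S ] ∃[ T ] (Split W S T × IsBasisOf 𝓛M Y T × UniqueListIn (S ∩ B) n)

  optimalSpans : ∀ {Y W₁ W₂ B₁ K₂ S T : Subset U} {Lk} → IsBasisOf 𝓤 Y W₁ →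
                 W₂ ⊆ Y → Split W₂ B₁ K₂ → IsBasisOf 𝓛M Y K₂ →
                 Split W₁ S T → IsBasisOf 𝓛M Y T → Unique Lk → entries Lk ⊆ S ∩ B₁ →
                 ¬ Overlap Y W₁ B₁ (suc (length Lk)) → ∀ {x} → B₁ x → ¬ S x → ¬ 𝓛F (S ∪ ｛ x ｝)
  optimalSpans {W₁ = W₁} {B₁ = B₁} {S = S} {T} {Lk}
               W₁-basis W₂⊆Y sp₂ K₂-basis sp T-basis uLk Lk⊆ noBetter {x} B₁x ¬Sx lS+x with em₀ {W₁ x}
  -- x ∉ W₁: adding x to the F-side enlarges the union-basis W₁
  ... | no ¬W₁x = maximal W₁-basis (W₂⊆Y (S⊆W sp₂ B₁x)) ¬W₁x (extendF sp lS+x)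
  -- x ∈ W₁, so x ∈ T; augmenting T ∖ {x} from the M-basis K₂ of Y brings in some k ∈ K₂
  ... | yes W₁x with M.basisAugment {A = T ∖ ｛ x ｝} {y = x} K₂-basis (λ (t , _) → within T-basis t) (M.indep-⊆ (indep T-basis) proj₁)
                       (W₂⊆Y (S⊆W sp₂ B₁x)) (λ (_ , x≢x) → x≢x refl)
                       (M.indep-⊆ (indep T-basis) (insert-⊆ {A = T ∖ ｛ x ｝} proj₁ (split-right sp W₁x ¬Sx)))
  ...   | k , K₂k , ¬T-x∋k , lT' with em₀ {W₁ k}
  -- k ∉ W₁: W₁ ∪ {k} is covered by (S ∪ {x}) ∪ ((T ∖ {x}) ∪ {k}), contradicting saturation of W₁
  ...     | no ¬W₁k = maximal W₁-basis (W₂⊆Y (T⊆W sp₂ K₂k)) ¬W₁k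
                        (union-indep lS+x lT' cover (λ s → inj₁ (insert-⊆ {A = S} (S⊆W sp) W₁x s))
                                     (insert-mono {A = T ∖ ｛ x ｝} (λ (t , _) → T⊆W sp t)))
    where
    cover : W₁ ∪ ｛ k ｝ ⊆ (S ∪ ｛ x ｝) ∪ ((T ∖ ｛ x ｝) ∪ ｛ k ｝)
    cover (inj₂ z≡k) = inj₂ (inj₂ z≡k)
    cover {z} (inj₁ W₁z) with covers sp W₁z | em₀ {z ≡ x}
    ... | inj₁ Sz | _        = inj₁ (inj₁ Sz)
    ... | inj₂ _  | yes z≡x  = inj₁ (inj₂ z≡x)
    ... | inj₂ Tz | no z≢x   = inj₂ (inj₁ (Tz , z≢x))
  -- k ∈ W₁, so k ∈ S: swapping x and k gives a split sharing one more element with B₁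
  ...     | yes W₁k = noBetter (_ , _ , swapSplit {x = x} {k = k} sp Tx Sk lS+x lT' ,
                                M.exchangeBasis {x = x} {k = k} T-basis (W₂⊆Y (T⊆W sp₂ K₂k)) ¬Tk lT' ,
                                x ∷ Lk , unique-cons (λ m → ¬Sx (proj₁ (Lk⊆ m))) uLk , entries-x∷Lk , refl)
    where
    Tx : T x
    Tx = split-right sp W₁x ¬Sx
    ¬B₁k : ¬ B₁ k
    ¬B₁k B₁k = disjoint sp₂ B₁k K₂k
    x≢k : x ≢ k
    x≢k x≡k = ¬B₁k (subst B₁ x≡k B₁x)
    ¬Tk : ¬ T k
    ¬Tk Tk = ¬T-x∋k (Tk , λ k≡x → x≢k (sym k≡x))
    Sk : S k
    Sk = split-left sp W₁k ¬Tk
    entries-x∷Lk : entries (x ∷ Lk) ⊆ ((S ∪ ｛ x ｝) ∖ ｛ k ｝) ∩ B₁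
    entries-x∷Lk (here refl) = (inj₂ refl , x≢k) , B₁x
    entries-x∷Lk (there m) with Lk⊆ m
    ... | Sz , B₁z = (inj₁ Sz , λ z≡k → ¬B₁k (subst B₁ z≡k B₁z)) , B₁z

  module WithFiniteRank {B₀ : Subset U} (B₀-max : IsMaximal 𝓛F B₀) (bs : List U) (B₀⊆bs : B₀ ⊆ entries bs) where
    open F.FiniteRank B₀-max bs B₀⊆bs
    open Enumeration

    -- The F-side of an adapted split of a union-basis of Y is at least as large as the F-side of an
    -- adapted split of any W₂ ⊆ Y: an overlap-maximal split has an F-side that spans B₁ and has at
    -- most |A₁| elements.
    fPartBound : ∀ {Y W₁ W₂ A₁ K₁ B₁ K₂ : Subset U} →
                 IsBasisOf 𝓤 Y W₁ → Split W₁ A₁ K₁ → IsBasisOf 𝓛M Y K₁ →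
                 W₂ ⊆ Y → Split W₂ B₁ K₂ → IsBasisOf 𝓛M Y K₂ →
                 ∀ {L} → Unique L → entries L ⊆ B₁ → ∀ cs → A₁ ⊆ entries cs → length L ≤ length cs
    fPartBound {Y} {W₁} {A₁ = A₁} {K₁} {B₁} W₁-basis sp₁ K₁-basis W₂⊆Y sp₂ K₂-basis {L} uL L⊆B₁ cs A₁⊆cs
      with lastWitness (Overlap Y W₁ B₁) (λ _ → em₁) (length (list (enumerate (indepF sp₂))))
                       (A₁ , K₁ , sp₁ , K₁-basis , [] , [] , (λ ()) , refl)
                       (λ n (_ , _ , _ , _ , Lk , uLk , Lk⊆ , |Lk|≡n) →
                          subst (_≤ _) |Lk|≡n (unique-length-≤ uLk (λ m → complete (enumerate (indepF sp₂)) (proj₂ (Lk⊆ m)))))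
    ... | _ , (S , T , sp , T-basis , Lk , uLk , Lk⊆ , refl) , noBetter = ≤-trans L≤S S≤cs
      where
      S-list : Enumeration S
      S-list = enumerate (indepF sp)
      -- by optimality S spans B₁ in F, so S is an F-basis of S ∪ B₁ and bounds the independent B₁
      saturated : ∀ {x} → (S ∪ B₁) x → ¬ S x → ¬ 𝓛F (S ∪ ｛ x ｝)
      saturated (inj₁ Sx) ¬Sx = ⊥-elim (¬Sx Sx)
      saturated (inj₂ B₁x) ¬Sx = optimalSpans W₁-basis W₂⊆Y sp₂ K₂-basis sp T-basis uLk Lk⊆ noBetter B₁x ¬Sx
      L≤S : length L ≤ length (list S-list)
      L≤S = F.independentBound (list S-list) (basis inj₁ (indepF sp) saturated) inj₂ (indepF sp₂) (λ w → w)
                               (complete S-list) uL L⊆B₁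
      -- S lies in W₁ outside the M-basis T of W₁, while W₁ ∖ K₁ ⊆ A₁
      cover : W₁ ∖ K₁ ⊆ entries cs
      cover (W₁x , ¬K₁x) = A₁⊆cs (split-left sp₁ W₁x ¬K₁x)
      S≤cs : length (list S-list) ≤ length cs
      S≤cs = M.basisDefect cs (basis-restrict T-basis (T⊆W sp) (within W₁-basis)) (T⊆W sp₁) (indepM sp₁) cover
                           (unique S-list) (λ m → S⊆W sp (sound S-list m) , disjoint sp (sound S-list m))

    outsideBasisBound : ∀ {W I : Subset U} → IsBasisOf 𝓛M W I → 𝓤 W →
                        ∀ {L} → Unique L → entries L ⊆ W ∖ I → length L ≤ length bs
    outsideBasisBound {W} I-basis uW uL L⊆ with split uW
    ... | S , T , sp = ≤-trans (M.basisDefect (list S-list) I-basis (T⊆W sp) (indepM sp) cover uL L⊆)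
                               (rankBound (indepF sp) (unique S-list) (sound S-list))
      where
      S-list : Enumeration S
      S-list = enumerate (indepF sp)
      cover : W ∖ T ⊆ entries (list S-list)
      cover (Wx , ¬Tx) = complete S-list (split-left sp Wx ¬Tx)

    Candidate : (A X I : Subset U) → ℕ → Set₁
    Candidate A X I n = ∃[ W ] ((𝓤 W × A ⊆ W × W ⊆ X × I ⊆ W) × UniqueListIn (W ∖ I) n)

    -- axiom I4 for the union: a candidate with the most elements outside an M-basis I of X is maximal
    union-I4 : ∀ (A X : Subset U) → 𝓤 A → A ⊆ X → X ⊆ EF ∪ EM →
               ∃[ S ] IsMaximal (λ (T : Subset U) → 𝓤 T × A ⊆ T × T ⊆ X) S
    union-I4 A X uA A⊆X _ with split uA
    ... | SA , TA , spA with M.extendToBasis (indepM spA) (λ t → A⊆X (T⊆W spA t))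
    ... | I , TA⊆I , I-basis
      with lastWitness (Candidate A X I) (λ _ → em₁) (length bs) (A ∪ I , (uA∪I , inj₁ , A∪I⊆X , inj₂) , [] , [] , (λ ()) , refl)
             (λ n (W , (uW , _ , W⊆X , I⊆W) , L , uL , L⊆ , |L|≡n) →
                subst (_≤ length bs) |L|≡n (outsideBasisBound (basis-restrict I-basis I⊆W W⊆X) uW uL L⊆))
      where
      cover : A ∪ I ⊆ SA ∪ I
      cover (inj₁ Ax) = [ inj₁ , (λ t → inj₂ (TA⊆I t)) ]′ (covers spA Ax)
      cover (inj₂ Ix) = inj₂ Ix
      uA∪I : 𝓤 (A ∪ I)
      uA∪I = union-indep (indepF spA) (indep I-basis) cover (λ s → inj₁ (S⊆W spA s)) inj₂
      A∪I⊆X : A ∪ I ⊆ X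
      A∪I⊆X (inj₁ Ax) = A⊆X Ax
      A∪I⊆X (inj₂ Ix) = within I-basis Ix
    ... | _ , (W , (uW , A⊆W , W⊆X , I⊆W) , L , uL , L⊆ , refl) , noLarger = W , (uW , A⊆W , W⊆X) , W-maximal
      where
      W-maximal : ∀ (T : Subset U) → 𝓤 T × A ⊆ T × T ⊆ X → W ⊆ T → T ⊆ W
      W-maximal T (uT , A⊆T , T⊆X) W⊆T {x} Tx = dne₀ λ ¬Wx →
        noLarger (W ∪ ｛ x ｝ ,
                  (union-I2 uT (insert-⊆ W⊆T Tx) , (λ a → inj₁ (A⊆W a)) , insert-⊆ W⊆X (T⊆X Tx) , (λ i → inj₁ (I⊆W i))) ,
                  x ∷ L , unique-cons (λ m → ¬Wx (proj₁ (L⊆ m))) uL , entries-x∷L ¬Wx , refl)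
        where
        entries-x∷L : ¬ W x → entries (x ∷ L) ⊆ (W ∪ ｛ x ｝) ∖ I
        entries-x∷L ¬Wx (here refl) = inj₂ refl , λ Ix → ¬Wx (I⊆W Ix)
        entries-x∷L ¬Wx (there m) = inj₁ (proj₁ (L⊆ m)) , proj₂ (L⊆ m)

    noAugmentation : ∀ {A B : Subset U} {y} → IsMaximal 𝓤 B → 𝓤 A → ¬ A y → 𝓤 (A ∪ ｛ y ｝) →
                     ¬ (∀ {b} → B b → ¬ A b → ¬ 𝓤 (A ∪ ｛ b ｝))
    noAugmentation {A} {B} {y} B-max uA ¬Ay uA+y stuck =
      count (adaptedSplit A-basis) (adaptedSplit B-basis) (adaptedSplit (selfBasis uA+y))
      where
      X Y : Subset U
      X = A ∪ B
      Y = X ∪ ｛ y ｝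
      A-basis : IsBasisOf 𝓤 X A
      A-basis = basis inj₁ uA saturated
        where
        saturated : ∀ {x} → X x → ¬ A x → ¬ 𝓤 (A ∪ ｛ x ｝)
        saturated (inj₁ Ax) ¬Ax = ⊥-elim (¬Ax Ax)
        saturated (inj₂ Bx) ¬Ax = stuck Bx ¬Ax
      B-basis : IsBasisOf 𝓤 Y B
      B-basis = maximal⇒basis B-max (λ b → inj₁ (inj₂ b))
      C⊆Y : A ∪ ｛ y ｝ ⊆ Y
      C⊆Y = insert-mono {A = A} {B = X} inj₁
      -- With adapted splits (A₁, JA), (B₁, JB), (C₁, K) of A, B and C = A ∪ {y}, counting F-parts gives
      -- |A₁| + 1 ≤ |C₁| ≤ |B₁| ≤ |A₁|.
      count : ∃[ A₁ ] ∃[ JA ] (Split A A₁ JA × IsBasisOf 𝓛M X JA) →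
              ∃[ B₁ ] ∃[ JB ] (Split B B₁ JB × IsBasisOf 𝓛M Y JB) →
              ∃[ C₁ ] ∃[ K ] (Split (A ∪ ｛ y ｝) C₁ K × IsBasisOf 𝓛M (A ∪ ｛ y ｝) K) → ⊥
      count (A₁ , JA , spA , JA-basisX) (B₁ , JB , spB , JB-basisY) (C₁ , K , spC , K-basisC) =
        n≮n (length (list a)) (≤-trans C-step (≤-trans B-step A-step))
        where
        a : Enumeration A₁
        a = enumerate (indepF spA)
        b : Enumeration B₁
        b = enumerate (indepF spB)
        c : Enumeration C₁
        c = enumerate (indepF spC)
        JB⊆X : JB ⊆ X
        JB⊆X j = inj₂ (T⊆W spB j)
        JA⊆C : JA ⊆ A ∪ ｛ y ｝
        JA⊆C j = inj₁ (T⊆W spA j)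
        JB-basisX : IsBasisOf 𝓛M X JB
        JB-basisX = basis-restrict JB-basisY JB⊆X inj₁
        JA-basisY : IsBasisOf 𝓛M Y JA
        JA-basisY = M.basis-lift JB-basisY JB⊆X inj₁ JA-basisX
        K-basisY : IsBasisOf 𝓛M Y K
        K-basisY = M.basis-lift JA-basisY JA⊆C C⊆Y K-basisC
        y∷a⊆C∖JA : entries (y ∷ list a) ⊆ (A ∪ ｛ y ｝) ∖ JA
        y∷a⊆C∖JA (here refl) = inj₂ refl , λ JAy → ¬Ay (T⊆W spA JAy)
        y∷a⊆C∖JA (there m) = inj₁ (S⊆W spA (sound a m)) , disjoint spA (sound a m)
        C-step : suc (length (list a)) ≤ length (list c)
        C-step = M.basisDefect (list c) (basis-restrict JA-basisY JA⊆C C⊆Y) (T⊆W spC) (indepM spC)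
                   (λ (Cx , ¬Kx) → complete c (split-left spC Cx ¬Kx))
                   (unique-cons (λ m → ¬Ay (S⊆W spA (sound a m))) (unique a)) y∷a⊆C∖JA
        B-step : length (list c) ≤ length (list b)
        B-step = fPartBound B-basis spB JB-basisY C⊆Y spC K-basisY (unique c) (sound c) (list b) (complete b)
        A-step : length (list b) ≤ length (list a)
        A-step = fPartBound A-basis spA JA-basisX inj₂ spB JB-basisX (unique b) (sound b) (list a) (complete a)

    union-I3 : ∀ (A B : Subset U) → IsMaximal 𝓤 B → 𝓤 A → ¬ IsMaximal 𝓤 A →
               ∃[ b ] (B b × ¬ A b × 𝓤 (A ∪ ｛ b ｝))
    union-I3 A B B-max uA A-notMax with augmentable em₀ em₁ union-I2 uA A-notMax
    ... | y , ¬Ay , uA+y = em⇒dne em₁ λ none →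
      noAugmentation B-max uA ¬Ay uA+y (λ {b} Bb ¬Ab uA+b → none (b , Bb , ¬Ab , uA+b))

    unionIsMatroid : IsMatroid (EF ∪ EM) 𝓤
    unionIsMatroid = record
      { indep⊆E = λ W (S , T , lS , lT , W⊆S∪T , _) Wx →
          [ (λ Sx → inj₁ (IsMatroid.indep⊆E MF S lS Sx)) , (λ Tx → inj₂ (IsMatroid.indep⊆E MM T lT Tx)) ]′ (W⊆S∪T Wx)
      ; I1 = union-indep (IsMatroid.I1 MF) (IsMatroid.I1 MM) (λ ()) (λ ()) (λ ())
      ; I2 = λ A B uB A⊆B → union-I2 uB A⊆B
      ; I3 = union-I3
      ; I4 = union-I4
      }

theorem3p5p1 : ExcludedMiddle 0ℓ → ExcludedMiddle (lsuc 0ℓ) →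
    {U : Set} (EF EM : Subset U) (𝓛F 𝓛M : Family U) →
    IsMatroid EF 𝓛F → HasFiniteRank 𝓛F → IsMatroid EM 𝓛M →
    IsMatroid (EF ∪ EM) (UnionFamily 𝓛F 𝓛M)
theorem3p5p1 em₀ em₁ EF EM 𝓛F 𝓛M MF (B₀ , B₀-max , bs , B₀⊆bs) MM =
  UnionMatroid.WithFiniteRank.unionIsMatroid em₀ em₁ MF MM B₀-max bs (λ {x} → B₀⊆bs x)
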